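{- Reasoning constructively (without excluded middle): there is no family of bijections $(\varphi_\chi \colon 2\mathbb{Z} \to 2\mathbb{Z}+1)_{\chi \in \mathbb{Z}_\infty}$ that is both continuous and equivariant in $\mathbb{Z}_\infty$.
   Context: Let $D_\infty = \langle t, r \mid r^2 = 1,\ r t r = t^{ -1}\rangle$ be the infinite dihedral group. It acts on $\mathbb{Z}$ by $t \cdot n = n+2$ and $r \cdot n = -n$; this restricts to actions on the even integers $2\mathbb{Z}$ and on the odd integers $2\mathbb{Z}+1$. It acts on $2^{\mathbb{Z}}$ (functions $\mathbb{Z} \to \{0,1\}$) by $(t\cdot\chi)(n) = \chi(n-2)$ and $(r \cdot \chi)(n) = 1 - \chi(-n)$. Let $\mathbb{Z}_\infty \subseteq 2^{\mathbb{Z}}$ be the set of decreasing sequences (those $\chi$ with $\chi(i) \geq \chi(j)$ whenever $i \leq j$); it is closed under the action. A family of bijections $(\varphi_\chi)_{\chi \in \mathbb{Z}_\infty}$ from $2\mathbb{Z}$ to $2\mathbb{Z}+1$ is equivariant if $\varphi_{g \cdot \chi}(g \cdot n) = g \cdot \varphi_\chi(n)$ for all $g \in D_\infty$, $\chi \in \mathbb{Z}_\infty$, $n \in 2\mathbb{Z}$; it is continuous if for every $\chi \in \mathbb{Z}_\infty$ and $n \in 2\mathbb{Z}$ there exists $N \in \mathbb{N}$ such that for all $\chi' \in \mathbb{Z}_\infty$ with $\chi'(m) = \chi(m)$ for all $m$ with $|m| < N$, we have $\varphi_{\chi'}(n) = \varphi_\chi(n)$. -}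

module Defs where

open import Data.Bool using (Bool; true; false; not; if_then_else_)
  renaming (_≤_ to _≤ᵇ_)
import Data.Bool as B
open import Data.Integer using (ℤ; +_; _+_; _-_; -_; _*_; _≤_; ∣_∣)
open import Data.Integer.Properties using (neg-mono-≤; +-monoˡ-≤)
open import Data.Integer.Tactic.RingSolver using (solve-∀)
open import Data.Nat as ℕ using (ℕ)
open import Data.Product using (Σ; ∃; ∃-syntax; _×_; _,_; proj₁)
open import Function.Definitions using (Bijective)
open import Relation.Binary.PropositionalEquality using (_≡_; refl; cong; trans)

-- The infinite dihedral group D∞ = ⟨ t, r | r² = 1, r t r = t⁻¹ ⟩.
-- Every element is uniquely of the form t^k r^b (k ∈ ℤ, b ∈ {0,1});
-- we represent D∞ by these normal forms.

record D∞ : Set where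
  constructor _∙r^_
  field
    tpow : ℤ
    refl? : Bool  -- b, for r^b  (true = r)

two : ℤ
two = + 2

-- Action on ℤ:  t · n = n + 2,  r · n = - n.
-- Hence (t^k r^b) · n = (±n) + 2k.

rActℤ : Bool → ℤ → ℤ
rActℤ false n = n
rActℤ true  n = - n

actℤ : D∞ → ℤ → ℤ
actℤ (k ∙r^ b) n = rActℤ b n + two * k

IsEven : ℤ → Set
IsEven n = ∃[ m ] n ≡ two * m

IsOdd : ℤ → Set
IsOdd n = ∃[ m ] n ≡ two * m + + 1

2ℤ : Set
2ℤ = Σ ℤ IsEven

2ℤ+1 : Set
2ℤ+1 = Σ ℤ IsOdd

_≈E_ : 2ℤ → 2ℤ → Set
x ≈E y = proj₁ x ≡ proj₁ y

_≈O_ : 2ℤ+1 → 2ℤ+1 → Set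
x ≈O y = proj₁ x ≡ proj₁ y

private
  ev-t : ∀ m k → two * m + two * k ≡ two * (m + k)
  ev-t = solve-∀
  ev-r : ∀ m k → - (two * m) + two * k ≡ two * (- m + k)
  ev-r = solve-∀
  od-t : ∀ m k → two * m + + 1 + two * k ≡ two * (m + k) + + 1
  od-t = solve-∀
  od-r : ∀ m k → - (two * m + + 1) + two * k ≡ two * (k - m - + 1) + + 1
  od-r = solve-∀

actEven : (g : D∞) → 2ℤ → 2ℤ
actEven (k ∙r^ false) (n , m , e) =
  (n + two * k) , (m + k) , trans (cong (λ x → x + two * k) e) (ev-t m k)
actEven (k ∙r^ true) (n , m , e) =
  (- n + two * k) , (- m + k) , trans (cong (λ x → - x + two * k) e) (ev-r m k)

actOdd : (g : D∞) → 2ℤ+1 → 2ℤ+1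
actOdd (k ∙r^ false) (n , m , e) =
  (n + two * k) , (m + k) , trans (cong (λ x → x + two * k) e) (od-t m k)
actOdd (k ∙r^ true) (n , m , e) =
  (- n + two * k) , (k - m - + 1) , trans (cong (λ x → - x + two * k) e) (od-r m k)

-- Action on 2^ℤ (functions ℤ → {0,1}, with 0 = false, 1 = true):
--   (t · χ)(n) = χ(n - 2),   (r · χ)(n) = 1 - χ(-n).
-- Hence (t^k r^b · χ)(n) = (r^b · χ)(n - 2k).

rActχ : Bool → (ℤ → Bool) → (ℤ → Bool)
rActχ false χ n = χ n
rActχ true  χ n = not (χ (- n))

actχ : D∞ → (ℤ → Bool) → (ℤ → Bool)
actχ (k ∙r^ b) χ n = rActχ b χ (n - two * k)

Decreasing : (ℤ → Bool) → Set
Decreasing χ = ∀ i j → i ≤ j → χ j ≤ᵇ χ i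

private
  not-anti : ∀ {a b} → a ≤ᵇ b → not b ≤ᵇ not a
  not-anti B.f≤t = B.f≤t
  not-anti B.b≤b = B.b≤b

actχ-dec : ∀ g {χ} → Decreasing χ → Decreasing (actχ g χ)
actχ-dec (k ∙r^ false) d i j i≤j =
  d (i - two * k) (j - two * k) (+-monoˡ-≤ (- (two * k)) i≤j)
actχ-dec (k ∙r^ true) d i j i≤j =
  not-anti (d (- (j - two * k)) (- (i - two * k))
    (neg-mono-≤ (+-monoˡ-≤ (- (two * k)) i≤j)))

ℤ∞ : Set
ℤ∞ = Σ (ℤ → Bool) Decreasing

actℤ∞ : D∞ → ℤ∞ → ℤ∞
actℤ∞ g (χ , d) = actχ g χ , actχ-dec g d

Family : Set
Family = ℤ∞ → 2ℤ → 2ℤ+1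

FamilyOfBijections : Family → Set
FamilyOfBijections φ = ∀ χ → Bijective _≈E_ _≈O_ (φ χ)

Equivariant : Family → Set
Equivariant φ = ∀ (g : D∞) (χ : ℤ∞) (n : 2ℤ) →
  φ (actℤ∞ g χ) (actEven g n) ≈O actOdd g (φ χ n)

AgreeBelow : ℕ → ℤ∞ → ℤ∞ → Set
AgreeBelow N χ χ' = ∀ (m : ℤ) → ∣ m ∣ ℕ.< N → proj₁ χ' m ≡ proj₁ χ m

Continuous : Family → Set
Continuous φ = ∀ (χ : ℤ∞) (n : 2ℤ) → ∃[ N ] ∀ (χ' : ℤ∞) →
  AgreeBelow N χ χ' → φ χ' n ≈O φ χ n

module Submission where

-- Let N witness continuity of φ at the constant sequence 1 and the point 0, and let
-- φ_1(0) = 2d + 1.  Let s ∈ ℤ∞ be the step sequence (1 on (-∞,0], 0 on (0,∞)) and write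
-- φ_s(2x) = 2 f(x) + 1.  For x ≤ -N the translate t^(-x)·s, and for x ≥ N the reflected
-- translate t^x r·s, agree with 1 on |m| < N and carry 2x to 0; equivariance plus continuity
-- then force f(x) = x + d on (-∞,-N] and f(x) = x - d - 1 on [N,∞).  But a bijection of ℤ
-- that is eventually a translation at both ends translates by the same amount at both ends,
-- while d ≠ -d - 1 (one of them is negative, the other is not).

open import Defs

open import Axiom.UniquenessOfIdentityProofs using (module Decidable⇒UIP)
open import Data.Bool using (Bool; true; false; not; b≤b; f≤t)
import Data.Bool.Properties as BoolP
open import Data.Fin using (Fin; toℕ; fromℕ<)
import Data.Fin.Properties as FinP
open import Data.Integer
  using (ℤ; +_; -[1+_]; 0ℤ; _+_; _-_; -_; _*_; ∣_∣; _≤_; _<_; +≤+; -≤+; -≤-; +<+)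
open import Data.Integer.Properties
  using ( ≤-refl; ≤-reflexive; ≤-trans; <⇒≤; <⇒≱; ≤⇒≯; ≰⇒>; ≮⇒≥; ≤-antisym; _≤?_; _<?_
        ; +-monoˡ-≤; +-monoˡ-<; +-monoʳ-<; +-mono-≤; i≤i+j; i≤j⇒i-k≤j; i≤j⇒i-j≤0; i≤j⇒0≤j-i
        ; neg-≤-pos; neg-mono-≤; neg-cancel-≤; neg-involutive; +-identityʳ; +-comm; +-inverseʳ
        ; 0≤i⇒+∣i∣≡i; +-injective; drop‿+<+; *-cancelˡ-≡; _≟_; module ≤-Reasoning)
open import Data.Integer.Tactic.RingSolver using (solve-∀)
open import Data.Nat as ℕ using (ℕ; zero; suc)
import Data.Nat.Properties as ℕP
open import Data.Product using (Σ; _×_; _,_; proj₁; proj₂; swap)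
open import Function.Definitions using (Injective; Bijective)
open import Relation.Nullary using (¬_; yes; no; contradiction)
open import Relation.Binary.PropositionalEquality
  using (_≡_; refl; cong; sym; trans; subst; module ≡-Reasoning)

[i+k]-k≡i : ∀ i k → i + k - k ≡ i
[i+k]-k≡i = solve-∀

[i-k]+k≡i : ∀ i k → i - k + k ≡ i
[i-k]+k≡i = solve-∀

+-cancelʳ-≡ : ∀ k {i j} → i + k ≡ j + k → i ≡ j
+-cancelʳ-≡ k {i} {j} eq = begin
  i          ≡⟨ sym ([i+k]-k≡i i k) ⟩
  i + k - k  ≡⟨ cong (_- k) eq ⟩
  j + k - k  ≡⟨ [i+k]-k≡i j k ⟩
  j          ∎
  where open ≡-Reasoning

+-cancelˡ-≡ : ∀ k {i j} → k + i ≡ k + j → i ≡ j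
+-cancelˡ-≡ k {i} {j} eq = +-cancelʳ-≡ k (begin
  i + k  ≡⟨ +-comm i k ⟩
  k + i  ≡⟨ eq ⟩
  k + j  ≡⟨ +-comm k j ⟩
  j + k  ∎)
  where open ≡-Reasoning

i<j+k⇒i-k<j : ∀ {i j k} → i < j + k → i - k < j
i<j+k⇒i-k<j {i} {j} {k} lt = subst (i - k <_) ([i+k]-k≡i j k) (+-monoˡ-< (- k) lt)

i≤j+k⇒i-k≤j : ∀ {i j k} → i ≤ j + k → i - k ≤ j
i≤j+k⇒i-k≤j {i} {j} {k} le = subst (i - k ≤_) ([i+k]-k≡i j k) (+-monoˡ-≤ (- k) le)

j+k≤i⇒j≤i-k : ∀ {i j k} → j + k ≤ i → j ≤ i - k
j+k≤i⇒j≤i-k {i} {j} {k} le = subst (_≤ i - k) ([i+k]-k≡i j k) (+-monoˡ-≤ (- k) le)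

i<j⇒0<j-i : ∀ {i j} → i < j → 0ℤ < j - i
i<j⇒0<j-i {i} {j} lt = subst (_< j - i) (+-inverseʳ i) (+-monoˡ-< (- i) lt)

-∣i∣≤i : ∀ i → - + ∣ i ∣ ≤ i
-∣i∣≤i (+ n)    = neg-≤-pos
-∣i∣≤i -[1+ n ] = ≤-refl

i≤∣i∣ : ∀ i → i ≤ + ∣ i ∣
i≤∣i∣ (+ n)    = ≤-refl
i≤∣i∣ -[1+ n ] = -≤+

double-injective : ∀ {a b} → two * a ≡ two * b → a ≡ b
double-injective {a} {b} = *-cancelˡ-≡ two a b

odd-injective : ∀ {a b} → two * a + + 1 ≡ two * b + + 1 → a ≡ b
odd-injective eq = double-injective (+-cancelʳ-≡ (+ 1) eq)

-- d and -d-1 never coincide: exactly one of them is negative.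
translations-differ : ∀ d → ¬ d ≡ - d - + 1
translations-differ (+ zero)  ()
translations-differ (+ suc n) ()
translations-differ -[1+ n ]  ()

segment-pigeonhole : ∀ {n m} (h : ℕ → ℕ) → (∀ {i} → i ℕ.< n → h i ℕ.< m) →
  (∀ {i j} → i ℕ.< n → j ℕ.< n → h i ≡ h j → i ≡ j) → n ℕ.≤ m
segment-pigeonhole {n} {m} h bound h-inj = FinP.injective⇒≤ F-injective
  where
  F : Fin n → Fin m
  F i = fromℕ< (bound (FinP.toℕ<n i))

  F-injective : Injective _≡_ _≡_ F
  F-injective {i} {j} Fi≡Fj = FinP.toℕ-injective (h-inj (FinP.toℕ<n i) (FinP.toℕ<n j) (begin
    h (toℕ i)  ≡⟨ sym (FinP.toℕ-fromℕ< _) ⟩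
    toℕ (F i)  ≡⟨ cong toℕ Fi≡Fj ⟩
    toℕ (F j)  ≡⟨ FinP.toℕ-fromℕ< _ ⟩
    h (toℕ j)  ∎))
    where open ≡-Reasoning

interval-pigeonhole : (u : ℤ → ℤ) → Injective _≡_ _≡_ u → (lo lo' : ℤ) (n m : ℕ) →
  (∀ x → lo ≤ x → x < lo + + n → lo' ≤ u x × u x < lo' + + m) → n ℕ.≤ m
interval-pigeonhole u u-inj lo lo' n m maps = segment-pigeonhole h h-bound h-inj
  where
  h : ℕ → ℕ
  h i = ∣ u (lo + + i) - lo' ∣

  image-bounds : ∀ {i} → i ℕ.< n → lo' ≤ u (lo + + i) × u (lo + + i) < lo' + + m
  image-bounds {i} i<n = maps (lo + + i) (i≤i+j lo (+ i)) (+-monoʳ-< lo (+<+ i<n))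

  h-offset : ∀ {i} → i ℕ.< n → + h i ≡ u (lo + + i) - lo'
  h-offset i<n = 0≤i⇒+∣i∣≡i (i≤j⇒0≤j-i (proj₁ (image-bounds i<n)))

  h-bound : ∀ {i} → i ℕ.< n → h i ℕ.< m
  h-bound {i} i<n = drop‿+<+ (subst (_< + m) (sym (h-offset i<n))
    (i<j+k⇒i-k<j (subst (u (lo + + i) <_) (+-comm lo' (+ m)) (proj₂ (image-bounds i<n)))))

  h-inj : ∀ {i j} → i ℕ.< n → j ℕ.< n → h i ≡ h j → i ≡ j
  h-inj i<n j<n hi≡hj = +-injective (+-cancelˡ-≡ lo (u-inj (+-cancelʳ-≡ (- lo')
    (trans (sym (h-offset i<n)) (trans (cong +_ hi≡hj) (h-offset j<n))))))

-- Bijections of ℤ that are eventually translations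

record EventualTranslation (f : ℤ → ℤ) (a b : ℤ) : Set where
  field
    L R   : ℤ
    left  : ∀ x → x ≤ L → f x ≡ x + a
    right : ∀ x → R ≤ x → f x ≡ x + b

Inverses : (ℤ → ℤ) → (ℤ → ℤ) → Set
Inverses f g = (∀ x → g (f x) ≡ x) × (∀ y → f (g y) ≡ y)

inverses⇒injective : ∀ {f g} → Inverses f g → Injective _≡_ _≡_ f
inverses⇒injective {f} {g} (gf , _) {x} {y} fx≡fy = begin
  x          ≡⟨ sym (gf x) ⟩
  g (f x)    ≡⟨ cong g fx≡fy ⟩
  g (f y)    ≡⟨ gf y ⟩
  y          ∎
  where open ≡-Reasoning

-- If an injection f translates a region P by t and f(x) - t lies in P, then x = f(x) - t:
-- the value f(x) is already taken by the point f(x) - t of P.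
tail-preimage : ∀ {f t x} (P : ℤ → Set) → Injective _≡_ _≡_ f →
  (∀ y → P y → f y ≡ y + t) → P (f x - t) → f x - t ≡ x
tail-preimage {f} {t} {x} P f-inj translates p =
  f-inj (trans (translates (f x - t) p) ([i-k]+k≡i (f x) t))

-- Counting step.  If an injection translates by b + c left of lo and by b from lo + (m + c)
-- on, the m + c points of [lo, lo + (m + c)) must land in the m points of
-- [lo + b + c, lo + b + c + m), the values outside being taken by the tails; so c = 0.
squeeze : ∀ {f} → Injective _≡_ _≡_ f → (lo b : ℤ) (m c : ℕ) →
  (∀ x → x < lo → f x ≡ x + (b + + c)) →
  (∀ x → lo + + (m ℕ.+ c) ≤ x → f x ≡ x + b) → c ≡ 0
squeeze {f} f-inj lo b m c left right =
  ℕP.n≤0⇒n≡0 (ℕP.+-cancelˡ-≤ m c 0 (subst (m ℕ.+ c ℕ.≤_) (sym (ℕP.+-identityʳ m))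
    (interval-pigeonhole f f-inj lo (lo + s) (m ℕ.+ c) m lands)))
  where
  s hi : ℤ
  s  = b + + c
  hi = lo + + (m ℕ.+ c)

  lands : ∀ x → lo ≤ x → x < hi → lo + s ≤ f x × f x < lo + s + + m
  lands x lo≤x x<hi = above , below
    where
    above : lo + s ≤ f x
    above with lo + s ≤? f x
    ... | yes ok = ok
    ... | no lo+s≰fx = contradiction lo≤x (<⇒≱ x<lo)
      where
      fx-s<lo : f x - s < lo
      fx-s<lo = i<j+k⇒i-k<j (≰⇒> lo+s≰fx)
      x<lo : x < lo
      x<lo = subst (_< lo) (tail-preimage (_< lo) f-inj left fx-s<lo) fx-s<lo

    shifted-end : lo + s + + m - b ≡ hi
    shifted-end = move lo b (+ c) (+ m)
      where
      move : ∀ lo b c m → lo + (b + c) + m - b ≡ lo + (m + c)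
      move = solve-∀

    below : f x < lo + s + + m
    below with f x <? lo + s + + m
    ... | yes ok = ok
    ... | no fx≮end = contradiction x<hi (≤⇒≯ hi≤x)
      where
      hi≤fx-b : hi ≤ f x - b
      hi≤fx-b = subst (_≤ f x - b) shifted-end (+-monoˡ-≤ (- b) (≮⇒≥ fx≮end))
      hi≤x : hi ≤ x
      hi≤x = subst (hi ≤_) (tail-preimage (hi ≤_) f-inj right hi≤fx-b) hi≤fx-b

-- An injection translating by a near -∞ and by b near +∞ satisfies a ≤ b.
-- (If b < a, write a = b + c and apply the counting step to a window containing [L, R].)
translation-≤ : ∀ {f a b} → Injective _≡_ _≡_ f → EventualTranslation f a b → a ≤ b
translation-≤ {f} {a} {b} f-inj T with a ≤? b
... | yes a≤b = a≤b
... | no a≰b = ≤-reflexive a≡b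
  where
  open EventualTranslation T
  -- a = b + c, and [lo, M) is a window of length M + M + c around [L, R]
  c M : ℕ
  c = ∣ a - b ∣
  M = ∣ L ∣ ℕ.+ ∣ R ∣
  lo : ℤ
  lo = - + M - + c

  a≡b+c : a ≡ b + + c
  a≡b+c = begin
    a              ≡⟨ sym ([i-k]+k≡i a b) ⟩
    a - b + b      ≡⟨ cong (_+ b) (sym (0≤i⇒+∣i∣≡i (i≤j⇒0≤j-i (<⇒≤ (≰⇒> a≰b))))) ⟩
    + c + b        ≡⟨ +-comm (+ c) b ⟩
    b + + c        ∎
    where open ≡-Reasoning

  left-window : ∀ x → x < lo → f x ≡ x + (b + + c)
  left-window x x<lo = trans (left x x≤L) (cong (λ k → x + k) a≡b+c)
    where
    open ≤-Reasoning
    x≤L : x ≤ L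
    x≤L = begin
      x            ≤⟨ <⇒≤ x<lo ⟩
      - + M - + c  ≤⟨ i≤j⇒i-k≤j (+ c) ≤-refl ⟩
      - + M        ≤⟨ neg-mono-≤ (+≤+ (ℕP.m≤m+n ∣ L ∣ ∣ R ∣)) ⟩
      - + ∣ L ∣    ≤⟨ -∣i∣≤i L ⟩
      L            ∎

  right-window : ∀ x → lo + + (M ℕ.+ M ℕ.+ c) ≤ x → f x ≡ x + b
  right-window x end≤x = right x R≤x
    where
    open ≤-Reasoning
    window-end : ∀ M c → - M - c + (M + M + c) ≡ M
    window-end = solve-∀
    R≤x : R ≤ x
    R≤x = begin
      R                           ≤⟨ i≤∣i∣ R ⟩
      + ∣ R ∣                     ≤⟨ +≤+ (ℕP.m≤n+m ∣ R ∣ ∣ L ∣) ⟩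
      + M                         ≡⟨ sym (window-end (+ M) (+ c)) ⟩
      lo + + (M ℕ.+ M ℕ.+ c)      ≤⟨ end≤x ⟩
      x                           ∎

  a≡b : a ≡ b
  a≡b = begin
    a        ≡⟨ a≡b+c ⟩
    b + + c  ≡⟨ cong (λ k → b + + k) (squeeze f-inj lo b (M ℕ.+ M) c left-window right-window) ⟩
    b + 0ℤ   ≡⟨ +-identityʳ b ⟩
    b        ∎
    where open ≡-Reasoning

inverse-translation : ∀ {f g a b} → Inverses f g → EventualTranslation f a b →
  EventualTranslation g (- a) (- b)
inverse-translation {f} {g} {a} {b} (gf , _) T = record
  { L     = L + a
  ; R     = R + b
  ; left  = λ y y≤L+a → undo (left (y - a) (i≤j+k⇒i-k≤j y≤L+a))
  ; right = λ y R+b≤y → undo (right (y - b) (j+k≤i⇒j≤i-k R+b≤y))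
  }
  where
  open EventualTranslation T
  undo : ∀ {y t} → f (y - t) ≡ y - t + t → g y ≡ y - t
  undo {y} {t} eq = begin
    g y            ≡⟨ cong g (sym (trans eq ([i-k]+k≡i y t))) ⟩
    g (f (y - t))  ≡⟨ gf (y - t) ⟩
    y - t          ∎
    where open ≡-Reasoning

translation-≡ : ∀ {f g a b} → Inverses f g → EventualTranslation f a b → a ≡ b
translation-≡ inv T = ≤-antisym
  (translation-≤ (inverses⇒injective inv) T)
  (neg-cancel-≤ (translation-≤ (inverses⇒injective (swap inv)) (inverse-translation inv T)))

-- An element of 2ℤ is determined by its underlying integer, since the witness m of n = 2m
-- is unique and identity proofs in ℤ are unique.
even-≡ : (x y : 2ℤ) → x ≈E y → x ≡ y
even-≡ (n , m , p) (.n , m' , p') refl with double-injective (trans (sym p) p')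
... | refl = cong (λ q → n , m , q) (Decidable⇒UIP.≡-irrelevant _≟_ p p')

double : ℤ → 2ℤ
double a = two * a , a , refl

origin : 2ℤ
origin = double 0ℤ

induced : (2ℤ → 2ℤ+1) → ℤ → ℤ
induced ψ x = proj₁ (proj₂ (ψ (double x)))

induced-spec : ∀ ψ x → proj₁ (ψ (double x)) ≡ two * induced ψ x + + 1
induced-spec ψ x = proj₂ (proj₂ (ψ (double x)))

induced-inverse : ∀ ψ → Bijective _≈E_ _≈O_ ψ → Σ (ℤ → ℤ) (Inverses (induced ψ))
induced-inverse ψ (ψ-inj , ψ-surj) = g , (λ x → f-inj (fg (f x))) , fg
  where
  f : ℤ → ℤ
  f = induced ψ

  f-inj : Injective _≡_ _≡_ f
  f-inj {x} {y} fx≡fy = double-injective (ψ-inj (begin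
    proj₁ (ψ (double x))  ≡⟨ induced-spec ψ x ⟩
    two * f x + + 1       ≡⟨ cong (λ z → two * z + + 1) fx≡fy ⟩
    two * f y + + 1       ≡⟨ sym (induced-spec ψ y) ⟩
    proj₁ (ψ (double y))  ∎))
    where open ≡-Reasoning

  preimage : ℤ → 2ℤ
  preimage y = proj₁ (ψ-surj (two * y + + 1 , y , refl))

  g : ℤ → ℤ
  g y = proj₁ (proj₂ (preimage y))

  fg : ∀ y → f (g y) ≡ y
  fg y = odd-injective (begin
    two * f (g y) + + 1       ≡⟨ sym (induced-spec ψ (g y)) ⟩
    proj₁ (ψ (double (g y)))  ≡⟨ proj₂ (ψ-surj _) (sym (proj₂ (proj₂ (preimage y)))) ⟩
    two * y + + 1             ∎)
    where open ≡-Reasoning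

step-seq : ℤ → Bool
step-seq (+ zero)  = true
step-seq (+ suc _) = false
step-seq -[1+ _ ]  = true

step-nonpos : ∀ {x} → x ≤ 0ℤ → step-seq x ≡ true
step-nonpos {+ zero}  _ = refl
step-nonpos { -[1+ _ ]} _ = refl
step-nonpos {+ suc _} (+≤+ ())

step-pos : ∀ {x} → 0ℤ < x → step-seq x ≡ false
step-pos {+ suc _} _ = refl
step-pos {+ zero} (+<+ ())

step-decreasing : Decreasing step-seq
step-decreasing -[1+ _ ]   (+ zero)   -≤+       = b≤b
step-decreasing -[1+ _ ]   (+ suc _)  -≤+       = f≤t
step-decreasing _          _          (-≤- _)   = b≤b
step-decreasing (+ zero)   (+ zero)   (+≤+ _)   = b≤b
step-decreasing _          (+ suc _)  (+≤+ _)   = BoolP.≤-minimum _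

step : ℤ∞
step = step-seq , step-decreasing

all-true : ℤ∞
all-true = (λ _ → true) , (λ _ _ _ → b≤b)

below-double : ∀ {m N k} → ∣ m ∣ ℕ.< N → + N ≤ k → m < two * k
below-double {m} {N} {k} |m|<N N≤k = begin-strict
  m             ≤⟨ i≤∣i∣ m ⟩
  + ∣ m ∣       <⟨ +<+ |m|<N ⟩
  + N           ≡⟨ sym (+-identityʳ (+ N)) ⟩
  + N + 0ℤ      ≤⟨ +-mono-≤ N≤k (≤-trans (+≤+ ℕ.z≤n) N≤k) ⟩
  k + k         ≡⟨ doubling k ⟩
  two * k       ∎
  where
  open ≤-Reasoning
  doubling : ∀ k → k + k ≡ two * k
  doubling = solve-∀

-- The tails of φ_s, for a continuous equivariant family φ

module StepTails (φ : Family) (continuous : Continuous φ) (equivariant : Equivariant φ) where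

  N : ℕ
  N = proj₁ (continuous all-true origin)

  d : ℤ
  d = proj₁ (proj₂ (φ all-true origin))

  f : ℤ → ℤ
  f = induced (φ step)

  moved-to-origin : ∀ g x → proj₁ (actEven g (double x)) ≡ 0ℤ →
    AgreeBelow N all-true (actℤ∞ g step) →
    proj₁ (actOdd g (φ step (double x))) ≡ two * d + + 1
  moved-to-origin g x g2x≡0 close = begin
    proj₁ (actOdd g (φ step (double x)))                   ≡⟨ sym (equivariant g step (double x)) ⟩
    proj₁ (φ (actℤ∞ g step) (actEven g (double x)))        ≡⟨ cong (λ e → proj₁ (φ (actℤ∞ g step) e))
                                                                 (even-≡ _ origin g2x≡0) ⟩
    proj₁ (φ (actℤ∞ g step) origin)                        ≡⟨ proj₂ (continuous all-true origin) _ close ⟩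
    proj₁ (φ all-true origin)                              ≡⟨ proj₂ (proj₂ (φ all-true origin)) ⟩
    two * d + + 1                                          ∎
    where open ≡-Reasoning

  left-tail : ∀ x → x ≤ - + N → f x ≡ x + d
  left-tail x x≤-N = double-injective (begin
    two * f x                                     ≡⟨ isolate (f x) x ⟩
    two * f x + + 1 + two * (- x) - + 1 + two * x ≡⟨ cong (λ z → z + two * (- x) - + 1 + two * x)
                                                       (sym (induced-spec (φ step) x)) ⟩
    proj₁ (φ step (double x)) + two * (- x) - + 1 + two * x
                                                  ≡⟨ cong (λ z → z - + 1 + two * x) moved ⟩
    two * d + + 1 - + 1 + two * x                 ≡⟨ rearrange d x ⟩
    two * (x + d)                                 ∎)
    where
    open ≡-Reasoning
    g : D∞
    g = (- x) ∙r^ false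
    N≤-x : + N ≤ - x
    N≤-x = subst (_≤ - x) (neg-involutive (+ N)) (neg-mono-≤ x≤-N)
    close : AgreeBelow N all-true (actℤ∞ g step)
    close m |m|<N = step-nonpos (i≤j⇒i-j≤0 (<⇒≤ (below-double {m} |m|<N N≤-x)))
    cancels : ∀ x → two * x + two * (- x) ≡ 0ℤ
    cancels = solve-∀
    moved : proj₁ (φ step (double x)) + two * (- x) ≡ two * d + + 1
    moved = moved-to-origin g x (cancels x) close
    isolate : ∀ y x → two * y ≡ two * y + + 1 + two * (- x) - + 1 + two * x
    isolate = solve-∀
    rearrange : ∀ d x → two * d + + 1 - + 1 + two * x ≡ two * (x + d)
    rearrange = solve-∀

  right-tail : ∀ x → + N ≤ x → f x ≡ x + (- d - + 1)
  right-tail x N≤x = double-injective (begin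
    two * f x                                       ≡⟨ isolate (f x) x ⟩
    two * x - (- (two * f x + + 1) + two * x) - + 1 ≡⟨ cong (λ z → two * x - (- z + two * x) - + 1)
                                                         (sym (induced-spec (φ step) x)) ⟩
    two * x - (- proj₁ (φ step (double x)) + two * x) - + 1
                                                    ≡⟨ cong (λ z → two * x - z - + 1) moved ⟩
    two * x - (two * d + + 1) - + 1                 ≡⟨ rearrange d x ⟩
    two * (x + (- d - + 1))                         ∎)
    where
    open ≡-Reasoning
    g : D∞
    g = x ∙r^ true
    close : AgreeBelow N all-true (actℤ∞ g step)
    close m |m|<N = cong not (step-pos (subst (0ℤ <_) (flip m x)
      (i<j⇒0<j-i (below-double {m} |m|<N N≤x))))
      where
      flip : ∀ m x → two * x - m ≡ - (m - two * x)
      flip = solve-∀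
    cancels : ∀ x → - (two * x) + two * x ≡ 0ℤ
    cancels = solve-∀
    moved : - proj₁ (φ step (double x)) + two * x ≡ two * d + + 1
    moved = moved-to-origin g x (cancels x) close
    isolate : ∀ y x → two * y ≡ two * x - (- (two * y + + 1) + two * x) - + 1
    isolate = solve-∀
    rearrange : ∀ d x → two * x - (two * d + + 1) - + 1 ≡ two * (x + (- d - + 1))
    rearrange = solve-∀

  tails : EventualTranslation f d (- d - + 1)
  tails = record { L = - + N ; R = + N ; left = left-tail ; right = right-tail }

theorem5p2 : ¬ (Σ Family λ φ → FamilyOfBijections φ × Continuous φ × Equivariant φ)
theorem5p2 (φ , bijective , continuous , equivariant) =
  translations-differ d (translation-≡ (proj₂ (induced-inverse (φ step) (bijective step))) tails)
  where open StepTails φ continuous equivariant
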